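{- A $3$-graph $\mathcal{H}$ is orientable if and only if $\mathcal{H}$ contains no bottle (of any size) as a subhypergraph.
   Context: A $3$-graph is a $3$-uniform hypergraph. A $3$-graph $\mathcal{H}$ is orientable if there is a tournament $T$ on vertex set $V(\mathcal{H})$ such that every hyperedge of $\mathcal{H}$ is a cyclic (directed) triangle in $T$. For $\ell\ge 3$, the path $\mathcal{P}_\ell$ is the $3$-graph on $\{1,\ldots,\ell\}$ with hyperedges $\{i,i+1,i+2\}$, $1\le i\le \ell-2$. A surjective homomorphism from a $3$-graph $\mathcal{G}$ to a $3$-graph $\mathcal{F}$ is a surjective map $f:V(\mathcal{G})\to V(\mathcal{F})$ such that $\{f(v_1),f(v_2),f(v_3)\}\in\mathcal{F}$ whenever $\{v_1,v_2,v_3\}\in\mathcal{G}$, and every hyperedge of $\mathcal{F}$ is the image of some hyperedge of $\mathcal{G}$. For $k\ge 4$, a bottle of size $k+2$ is a $3$-graph $\mathcal{F}$ admitting a surjective homomorphism $f$ from $\mathcal{P}_{k+2}$ to $\mathcal{F}$ with $f(k+1)=f(2)$ and $f(k+2)=f(1)$; i.e., writing $v_i=f(i)$ for $1\le i\le k$ (repetitions among the $v_i$ allowed), its hyperedges are exactly the consecutive triples of the sequence $v_1v_2\ldots v_kv_2v_1$. -}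

module Defs where

open import Data.Nat using (ℕ; suc; _≤_)
open import Data.Fin using (Fin; zero; suc; inject₁; fromℕ)
open import Data.Bool using (Bool; true)
open import Data.Product using (Σ; _×_; ∃; ∃-syntax)
open import Data.Sum using (_⊎_)
open import Relation.Nullary using (¬_)
open import Relation.Binary.PropositionalEquality using (_≡_; _≢_)
open import Function.Definitions using (Injective)

-- A (candidate) 3-graph on the finite vertex set Fin n, given by a
-- decidable (Bool-valued) hyperedge predicate on ordered triples.
record 3Graph : Set where
  field
    n : ℕ
    E : Fin n → Fin n → Fin n → Bool

open 3Graph public

Edge : (G : 3Graph) → Fin (n G) → Fin (n G) → Fin (n G) → Set
Edge G a b c = E G a b c ≡ true

-- The predicate really describes a set of 3-element subsets:
-- invariant under permutations of the triple, and only distinct vertices.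
Is3Graph : 3Graph → Set
Is3Graph G =
  (∀ a b c → Edge G a b c → Edge G b a c) ×
  (∀ a b c → Edge G a b c → Edge G a c b) ×
  (∀ a b c → Edge G a b c → (a ≢ b) × (b ≢ c) × (a ≢ c))

IsTournament : {V : Set} → (V → V → Set) → Set
IsTournament {V} T =
  (∀ x → ¬ T x x) ×
  (∀ x y → x ≢ y → T x y ⊎ T y x) ×
  (∀ x y → T x y → ¬ T y x)

CyclicTriangle : {V : Set} → (V → V → Set) → V → V → V → Set
CyclicTriangle T a b c = (T a b × T b c × T c a) ⊎ (T b a × T c b × T a c)

Orientable : 3Graph → Set₁
Orientable H =
  Σ (Fin (n H) → Fin (n H) → Set) λ T →
    IsTournament T × (∀ a b c → Edge H a b c → CyclicTriangle T a b c)

SameTriple : {V : Set} → V → V → V → V → V → V → Set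
SameTriple a b c x y z =
  ((a ≡ x) × (b ≡ y) × (c ≡ z)) ⊎ ((a ≡ x) × (b ≡ z) × (c ≡ y)) ⊎
  ((a ≡ y) × (b ≡ x) × (c ≡ z)) ⊎ ((a ≡ y) × (b ≡ z) × (c ≡ x)) ⊎
  ((a ≡ z) × (b ≡ x) × (c ≡ y)) ⊎ ((a ≡ z) × (b ≡ y) × (c ≡ x))

-- Surjective homomorphism from the path P_{k+2} (vertex set Fin (k+2),
-- 0-indexed, hyperedges {i,i+1,i+2} for i : Fin k) onto F.
SurjHomFromPath : (k : ℕ) (F : 3Graph) → (Fin (suc (suc k)) → Fin (n F)) → Set
SurjHomFromPath k F f =
  (∀ v → ∃[ x ] f x ≡ v) ×
  (∀ (i : Fin k) → Edge F (f (inject₁ (inject₁ i))) (f (suc (inject₁ i))) (f (suc (suc i)))) ×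
  (∀ a b c → Edge F a b c → Σ (Fin k) λ i →
     SameTriple a b c (f (inject₁ (inject₁ i))) (f (suc (inject₁ i))) (f (suc (suc i))))

-- F is a bottle (of size k+2 for some k ≥ 4).  In 1-indexed notation the
-- conditions are f(k+1) = f(2) and f(k+2) = f(1); 0-indexed: f(k) = f(1), f(k+1) = f(0).
IsBottle : 3Graph → Set
IsBottle F =
  Is3Graph F ×
  Σ ℕ λ k → (4 ≤ k) × Σ (Fin (suc (suc k)) → Fin (n F)) λ f →
    SurjHomFromPath k F f ×
    (f (inject₁ (fromℕ k)) ≡ f (suc zero)) ×
    (f (fromℕ (suc k)) ≡ f zero)

-- F is a (not necessarily induced) subhypergraph of H, up to isomorphism:
-- an injective vertex map sending hyperedges to hyperedges.
IsSubhypergraph : 3Graph → 3Graph → Set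
IsSubhypergraph F H =
  Σ (Fin (n F) → Fin (n H)) λ g →
    Injective _≡_ _≡_ g × (∀ a b c → Edge F a b c → Edge H (g a) (g b) (g c))

ContainsBottle : 3Graph → Set
ContainsBottle H = Σ 3Graph λ F → IsBottle F × IsSubhypergraph F H

-- Call an ordered pair (a , b) linked to (b , c) whenever {a,b,c} is a hyperedge.
-- A tournament in which every hyperedge is cyclic orients (a , b) forwards
-- exactly when it orients (b , c) forwards, so no pair (x , y) with x ≠ y can be
-- linked to its reverse (y , x); a walk witnessing such a link is a sequence
-- x y … y x whose consecutive triples are hyperedges, i.e. a bottle.  Conversely,
-- if no pair is linked to its reverse, number the link classes of ordered pairs
-- and let x → y when the class of (x , y) has a smaller number than that of
-- (y , x); the three pairs (a , b), (b , c), (c , a) of a hyperedge lie in one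
-- class, which makes {a,b,c} a cyclic triangle.
module Submission where

open import Defs
open import Relation.Nullary using (¬_)
open import Function.Bundles using (_⇔_; mk⇔; module Equivalence)

open import Data.Nat as ℕ using (ℕ; zero; suc; _≤_; _<_; s≤s; z≤n)
open import Data.Nat.Properties using (<-cmp; <-irrefl; <-asym)
open import Data.Fin using (Fin; zero; suc; inject₁; fromℕ; toℕ; combine)
open import Data.Fin.Properties using (any?; _≟_; toℕ-injective; combine-injective)
open import Data.Bool using (true)
open import Data.Bool.Properties as Bool using (T-≡)
open import Data.Product using (Σ; _×_; _,_; proj₁; proj₂; ∃; ∃₂; uncurry)
open import Data.Sum using (_⊎_; inj₁; inj₂)
open import Data.Empty using (⊥-elim)
open import Data.List using (List; []; _∷_; length; lookup; filter; map; allFin; cartesianProduct)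
open import Data.List.Relation.Unary.Any as Any using (here; there)
open import Data.List.Relation.Unary.All as All using (All; []; _∷_)
open import Data.List.Relation.Unary.All.Properties using (all-filter) renaming (map⁺ to All-map⁺)
open import Data.List.Relation.Unary.AllPairs using (_∷_)
open import Data.List.Relation.Unary.Unique.Propositional using (Unique)
import Data.List.Relation.Unary.Unique.Propositional.Properties as Unique
open import Data.List.Membership.Propositional using (_∈_)
open import Data.List.Membership.Propositional.Properties
  using (∈-filter⁺; ∈-filter⁻; ∈-allFin; ∈-lookup; ∈-map⁺; ∈-cartesianProduct⁺)
open import Data.List.Relation.Unary.Any.Properties using (lookup-index)
open import Relation.Nullary.Decidable using (Dec; yes; no; isYes; _×-dec_; _⊎-dec_; toWitness; fromWitness)
open import Level using (_⊔_)
open import Relation.Binary.Bundles using (Setoid)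
open import Relation.Binary.Definitions using (Tri; tri<; tri≈; tri>)
open import Relation.Binary.Construct.Closure.ReflexiveTransitive using (Star; ε; _◅_; _◅◅_; reverse; concat)
open import Relation.Binary.PropositionalEquality
  using (_≡_; _≢_; refl; sym; trans; cong; cong₂; subst; subst₂)
open import Function.Base using (_∘_)
open import Function.Definitions using (Injective)

-- Unordered triples

Distinct : {V : Set} → V → V → V → Set
Distinct a b c = (a ≢ b) × (b ≢ c) × (a ≢ c)

Symmetric₃ : {V : Set} → (V → V → V → Set) → Set
Symmetric₃ P = (∀ {a b c} → P a b c → P b a c) × (∀ {a b c} → P a b c → P a c b)

module _ {V : Set} where

  SameTriple-swap₁₂ : ∀ {a b c x y z : V} → SameTriple a b c x y z → SameTriple b a c x y z
  SameTriple-swap₁₂ (inj₁ (p , q , r)) = inj₂ (inj₂ (inj₁ (q , p , r)))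
  SameTriple-swap₁₂ (inj₂ (inj₁ (p , q , r))) = inj₂ (inj₂ (inj₂ (inj₂ (inj₁ (q , p , r)))))
  SameTriple-swap₁₂ (inj₂ (inj₂ (inj₁ (p , q , r)))) = inj₁ (q , p , r)
  SameTriple-swap₁₂ (inj₂ (inj₂ (inj₂ (inj₁ (p , q , r))))) = inj₂ (inj₂ (inj₂ (inj₂ (inj₂ (q , p , r)))))
  SameTriple-swap₁₂ (inj₂ (inj₂ (inj₂ (inj₂ (inj₁ (p , q , r)))))) = inj₂ (inj₁ (q , p , r))
  SameTriple-swap₁₂ (inj₂ (inj₂ (inj₂ (inj₂ (inj₂ (p , q , r)))))) = inj₂ (inj₂ (inj₂ (inj₁ (q , p , r))))

  SameTriple-swap₂₃ : ∀ {a b c x y z : V} → SameTriple a b c x y z → SameTriple a c b x y z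
  SameTriple-swap₂₃ (inj₁ (p , q , r)) = inj₂ (inj₁ (p , r , q))
  SameTriple-swap₂₃ (inj₂ (inj₁ (p , q , r))) = inj₁ (p , r , q)
  SameTriple-swap₂₃ (inj₂ (inj₂ (inj₁ (p , q , r)))) = inj₂ (inj₂ (inj₂ (inj₁ (p , r , q))))
  SameTriple-swap₂₃ (inj₂ (inj₂ (inj₂ (inj₁ (p , q , r))))) = inj₂ (inj₂ (inj₁ (p , r , q)))
  SameTriple-swap₂₃ (inj₂ (inj₂ (inj₂ (inj₂ (inj₁ (p , q , r)))))) = inj₂ (inj₂ (inj₂ (inj₂ (inj₂ (p , r , q)))))
  SameTriple-swap₂₃ (inj₂ (inj₂ (inj₂ (inj₂ (inj₂ (p , q , r)))))) = inj₂ (inj₂ (inj₂ (inj₂ (inj₁ (p , r , q)))))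

  SameTriple-transport : (P : V → V → V → Set) → Symmetric₃ P →
    ∀ {a b c x y z} → SameTriple a b c x y z → P x y z → P a b c
  SameTriple-transport P (s₁₂ , s₂₃) (inj₁ (refl , refl , refl)) p = p
  SameTriple-transport P (s₁₂ , s₂₃) (inj₂ (inj₁ (refl , refl , refl))) p = s₂₃ p
  SameTriple-transport P (s₁₂ , s₂₃) (inj₂ (inj₂ (inj₁ (refl , refl , refl)))) p = s₁₂ p
  SameTriple-transport P (s₁₂ , s₂₃) (inj₂ (inj₂ (inj₂ (inj₁ (refl , refl , refl))))) p = s₂₃ (s₁₂ p)
  SameTriple-transport P (s₁₂ , s₂₃) (inj₂ (inj₂ (inj₂ (inj₂ (inj₁ (refl , refl , refl)))))) p = s₁₂ (s₂₃ p)
  SameTriple-transport P (s₁₂ , s₂₃) (inj₂ (inj₂ (inj₂ (inj₂ (inj₂ (refl , refl , refl)))))) p = s₁₂ (s₂₃ (s₁₂ p))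

  Distinct-symmetric : Symmetric₃ (Distinct {V})
  Distinct-symmetric = (λ (p , q , r) → (λ e → p (sym e)) , r , q)
                     , (λ (p , q , r) → r , (λ e → q (sym e)) , p)

  sameTriple? : ((x y : V) → Dec (x ≡ y)) → (a b c x y z : V) → Dec (SameTriple a b c x y z)
  sameTriple? _≟V_ a b c x y z =
    ((a ≟V x) ×-dec (b ≟V y) ×-dec (c ≟V z)) ⊎-dec ((a ≟V x) ×-dec (b ≟V z) ×-dec (c ≟V y)) ⊎-dec
    ((a ≟V y) ×-dec (b ≟V x) ×-dec (c ≟V z)) ⊎-dec ((a ≟V y) ×-dec (b ≟V z) ×-dec (c ≟V x)) ⊎-dec
    ((a ≟V z) ×-dec (b ≟V x) ×-dec (c ≟V y)) ⊎-dec ((a ≟V z) ×-dec (b ≟V y) ×-dec (c ≟V x))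

module _ {G : 3Graph} (isG : Is3Graph G) where

  Edge-symmetric : Symmetric₃ (Edge G)
  Edge-symmetric = (λ {a b c} → proj₁ isG a b c) , (λ {a b c} → proj₁ (proj₂ isG) a b c)

  Edge-distinct : ∀ {a b c} → Edge G a b c → Distinct a b c
  Edge-distinct {a} {b} {c} = proj₂ (proj₂ isG) a b c

  Edge-rotate : ∀ {a b c} → Edge G a b c → Edge G b c a
  Edge-rotate e = proj₂ Edge-symmetric (proj₁ Edge-symmetric e)

-- Image factorisation of a map between finite sets

lookup-injective : {A : Set} {xs : List A} → Unique xs → ∀ i j → lookup xs i ≡ lookup xs j → i ≡ j
lookup-injective (_ ∷ _) zero zero _ = refl
lookup-injective (x∉ ∷ _) zero (suc j) eq = ⊥-elim (All.lookup x∉ (∈-lookup j) eq)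
lookup-injective (x∉ ∷ _) (suc i) zero eq = ⊥-elim (All.lookup x∉ (∈-lookup i) (sym eq))
lookup-injective (_ ∷ u) (suc i) (suc j) eq = cong suc (lookup-injective u i j eq)

record ImageFactorisation {m N : ℕ} (w : Fin m → Fin N) : Set where
  field
    size : ℕ
    onto : Fin m → Fin size
    into : Fin size → Fin N
    onto-surjective : ∀ j → ∃ λ i → onto i ≡ j
    into-injective : Injective _≡_ _≡_ into
    factorises : ∀ i → into (onto i) ≡ w i

  onto-≡⇒≡ : ∀ {x y} → onto x ≡ onto y → w x ≡ w y
  onto-≡⇒≡ eq = trans (sym (factorises _)) (trans (cong into eq) (factorises _))

  ≡⇒onto-≡ : ∀ {x y} → w x ≡ w y → onto x ≡ onto y
  ≡⇒onto-≡ eq = into-injective (trans (factorises _) (trans eq (sym (factorises _))))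

image-factorisation : {m N : ℕ} (w : Fin m → Fin N) → ImageFactorisation w
image-factorisation {m} {N} w = record
  { size = length image
  ; onto = onto
  ; into = lookup image
  ; onto-surjective = onto-surjective
  ; into-injective = λ {i} {j} → lookup-injective image-unique i j
  ; factorises = factorises
  }
  where
    inImage? : (v : Fin N) → Dec (∃ λ i → w i ≡ v)
    inImage? v = any? (λ i → w i ≟ v)
    image : List (Fin N)
    image = filter inImage? (allFin N)
    image-unique : Unique image
    image-unique = Unique.filter⁺ inImage? (Unique.allFin⁺ N)
    w∈image : ∀ i → w i ∈ image
    w∈image i = ∈-filter⁺ inImage? (∈-allFin (w i)) (i , refl)
    onto : Fin m → Fin (length image)
    onto i = Any.index (w∈image i)
    factorises : ∀ i → lookup image (onto i) ≡ w i
    factorises i = sym (lookup-index (w∈image i))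
    onto-surjective : ∀ j → ∃ λ i → onto i ≡ j
    onto-surjective j with ∈-filter⁻ inImage? {xs = allFin N} (∈-lookup {xs = image} j)
    ... | _ , (i , wi≡j) = i , lookup-injective image-unique _ _ (trans (factorises i) wi≡j)

-- Merging labels

module Merging {c ℓ} (S : Setoid c ℓ) where

  open Setoid S using (Carrier; _≈_; reflexive) renaming (sym to ≈-sym; trans to ≈-trans)

  Labelling : Set c
  Labelling = Carrier → ℕ

  Faithful : Labelling → Set (c ⊔ ℓ)
  Faithful L = ∀ p q → L p ≡ L q → p ≈ q

  injective⇒faithful : ∀ {L} → Injective _≡_ _≡_ L → Faithful L
  injective⇒faithful L-injective p q eq = reflexive (L-injective eq)

  replace : ℕ → ℕ → ℕ → ℕ
  replace old new l with l ℕ.≟ old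
  ... | yes _ = new
  ... | no _ = l

  merge : Labelling → Carrier → Carrier → Labelling
  merge L x y p = replace (L y) (L x) (L p)

  merge-faithful : ∀ {L x y} → x ≈ y → Faithful L → Faithful (merge L x y)
  merge-faithful {L} {x} {y} x≈y faithful p q eq with L p ℕ.≟ L y | L q ℕ.≟ L y
  ... | yes Lp≡Ly | yes Lq≡Ly = ≈-trans (faithful p y Lp≡Ly) (≈-sym (faithful q y Lq≡Ly))
  ... | yes Lp≡Ly | no _ = ≈-trans (faithful p y Lp≡Ly) (≈-trans (≈-sym x≈y) (faithful x q eq))
  ... | no _ | yes Lq≡Ly = ≈-trans (faithful p x eq) (≈-trans x≈y (≈-sym (faithful q y Lq≡Ly)))
  ... | no _ | no _ = faithful p q eq

  merge-unifies : ∀ L x y → merge L x y x ≡ merge L x y y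
  merge-unifies L x y with L x ℕ.≟ L y | L y ℕ.≟ L y
  ... | _ | no Ly≢Ly = ⊥-elim (Ly≢Ly refl)
  ... | yes _ | yes _ = refl
  ... | no _ | yes _ = refl

  mergeAll : Labelling → List (Carrier × Carrier) → Labelling
  mergeAll L [] = L
  mergeAll L ((x , y) ∷ links) = mergeAll (merge L x y) links

  mergeAll-faithful : ∀ {L} links → All (uncurry _≈_) links → Faithful L → Faithful (mergeAll L links)
  mergeAll-faithful [] [] faithful = faithful
  mergeAll-faithful (_ ∷ links) (x≈y ∷ linked) faithful =
    mergeAll-faithful links linked (merge-faithful x≈y faithful)

  mergeAll-respects : ∀ {L p q} links → L p ≡ L q → mergeAll L links p ≡ mergeAll L links q
  mergeAll-respects [] eq = eq
  mergeAll-respects {L} ((x , y) ∷ links) eq = mergeAll-respects links (cong (replace (L y) (L x)) eq)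

  mergeAll-unifies : ∀ {L x y} links → (x , y) ∈ links → mergeAll L links x ≡ mergeAll L links y
  mergeAll-unifies {L} {x} {y} (_ ∷ links) (here refl) = mergeAll-respects links (merge-unifies L x y)
  mergeAll-unifies (_ ∷ links) (there x,y∈links) = mergeAll-unifies links x,y∈links

-- Homomorphic images of paths

PathHom : (G : 3Graph) (k : ℕ) → (Fin (suc (suc k)) → Fin (n G)) → Set
PathHom G k w = ∀ (i : Fin k) → Edge G (w (inject₁ (inject₁ i))) (w (suc (inject₁ i))) (w (suc (suc i)))

OnPath : {V : Set} {k : ℕ} → (Fin (suc (suc k)) → V) → V → V → V → Set
OnPath {k = k} w a b c =
  Σ (Fin k) λ i → SameTriple a b c (w (inject₁ (inject₁ i))) (w (suc (inject₁ i))) (w (suc (suc i)))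

module _ {H : 3Graph} (isH : Is3Graph H) {k : ℕ} (w : Fin (suc (suc k)) → Fin (n H))
         (hom : PathHom H k w) where

  open ImageFactorisation (image-factorisation w)

  private
    onPath? : (a b c : Fin size) → Dec (OnPath onto a b c)
    onPath? a b c = any? λ i → sameTriple? _≟_ a b c _ _ _

  pathImage : 3Graph
  pathImage = record { n = size ; E = λ a b c → isYes (onPath? a b c) }

  private
    edge⇒onPath : ∀ {a b c} → Edge pathImage a b c → OnPath onto a b c
    edge⇒onPath {a} {b} {c} e = toWitness {a? = onPath? a b c} (Equivalence.from T-≡ e)

    onPath⇒edge : ∀ {a b c} → OnPath onto a b c → Edge pathImage a b c
    onPath⇒edge {a} {b} {c} p = Equivalence.to T-≡ (fromWitness {a? = onPath? a b c} p)

    onto-distinct : ∀ {x y z} → Distinct (w x) (w y) (w z) → Distinct (onto x) (onto y) (onto z)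
    onto-distinct (p , q , r) = p ∘ onto-≡⇒≡ , q ∘ onto-≡⇒≡ , r ∘ onto-≡⇒≡

  pathImage-is3Graph : Is3Graph pathImage
  pathImage-is3Graph =
    (λ _ _ _ e → let i , st = edge⇒onPath e in onPath⇒edge (i , SameTriple-swap₁₂ st)) ,
    (λ _ _ _ e → let i , st = edge⇒onPath e in onPath⇒edge (i , SameTriple-swap₂₃ st)) ,
    (λ _ _ _ e → let i , st = edge⇒onPath e in
       SameTriple-transport Distinct Distinct-symmetric st (onto-distinct (Edge-distinct isH (hom i))))

  pathImage-subhypergraph : IsSubhypergraph pathImage H
  pathImage-subhypergraph = into , into-injective , λ _ _ _ e →
    let i , st = edge⇒onPath e in
    SameTriple-transport (λ x y z → Edge H (into x) (into y) (into z))
      ((λ {a b c} → proj₁ (Edge-symmetric isH)) , (λ {a b c} → proj₂ (Edge-symmetric isH))) st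
      (factorised-edge _ _ _ (hom i))
    where
      factorised-edge : ∀ x y z → Edge H (w x) (w y) (w z) → Edge H (into (onto x)) (into (onto y)) (into (onto z))
      factorised-edge x y z e rewrite factorises x | factorises y | factorises z = e

  pathImage-isBottle : 4 ≤ k → w (inject₁ (fromℕ k)) ≡ w (suc zero) → w (fromℕ (suc k)) ≡ w zero →
    IsBottle pathImage
  pathImage-isBottle 4≤k closes₁ closes₀ = pathImage-is3Graph , k , 4≤k , onto ,
    (onto-surjective , (λ i → onPath⇒edge (i , inj₁ (refl , refl , refl))) , (λ _ _ _ → edge⇒onPath)) ,
    ≡⇒onto-≡ closes₁ , ≡⇒onto-≡ closes₀

-- Linked ordered pairs

module _ (G : 3Graph) where

  Pair : Set
  Pair = Fin (n G) × Fin (n G)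

  data Shift : Pair → Pair → Set where
    shift : ∀ {a b c} → Edge G a b c → Shift (a , b) (b , c)

  Linked : Pair → Pair → Set
  Linked = Star Shift

  record Walk (x y u v : Fin (n G)) : Set where
    field
      len : ℕ
      vertex : Fin (suc (suc len)) → Fin (n G)
      hom : PathHom G len vertex
      starts₀ : vertex zero ≡ x
      starts₁ : vertex (suc zero) ≡ y
      ends₀ : vertex (inject₁ (fromℕ len)) ≡ u
      ends₁ : vertex (fromℕ (suc len)) ≡ v

  ReversiblePair : Set
  ReversiblePair = ∃₂ λ x y → x ≢ y × Linked (x , y) (y , x)

module _ {G : 3Graph} where

  path-linked : ∀ k (w : Fin (suc (suc k)) → Fin (n G)) → PathHom G k w →
    Linked G (w zero , w (suc zero)) (w (inject₁ (fromℕ k)) , w (fromℕ (suc k)))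
  path-linked zero w hom = ε
  path-linked (suc k) w hom = shift (hom zero) ◅ path-linked k (λ i → w (suc i)) (λ i → hom (suc i))

  walk-cons : ∀ {x y z u v} → Edge G x y z → Walk G y z u v → Walk G x y u v
  walk-cons {x} e W = record
    { len = suc len ; vertex = vertex′ ; hom = hom′
    ; starts₀ = refl ; starts₁ = starts₀ ; ends₀ = ends₀ ; ends₁ = ends₁ }
    where
      open Walk W
      vertex′ : Fin (suc (suc (suc len))) → Fin (n G)
      vertex′ zero = x
      vertex′ (suc j) = vertex j
      hom′ : PathHom G (suc len) vertex′
      hom′ zero = subst₂ (Edge G x) (sym starts₀) (sym starts₁) e
      hom′ (suc i) = hom i

  linked-walk : ∀ {x y u v} → Linked G (x , y) (u , v) → Walk G x y u v
  linked-walk {x} {y} ε = record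
    { len = 0 ; vertex = λ { zero → x ; (suc _) → y } ; hom = λ ()
    ; starts₀ = refl ; starts₁ = refl ; ends₀ = refl ; ends₁ = refl }
  linked-walk (shift e ◅ l) = walk-cons e (linked-walk l)

  module _ (isG : Is3Graph G) where

    Shift-reverse : ∀ {p q} → Shift G p q → Linked G q p
    Shift-reverse (shift e) = shift (Edge-rotate isG e) ◅ shift (Edge-rotate isG (Edge-rotate isG e)) ◅ ε

    Linked-sym : ∀ {p q} → Linked G p q → Linked G q p
    Linked-sym = concat ∘ reverse Shift-reverse

    Linked-setoid : Setoid _ _
    Linked-setoid = record
      { Carrier = Pair G
      ; _≈_ = Linked G
      ; isEquivalence = record { refl = ε ; sym = Linked-sym ; trans = _◅◅_ } }

    reversingWalk-len≥4 : ∀ {x y} → x ≢ y → (W : Walk G x y y x) → 4 ≤ Walk.len W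
    reversingWalk-len≥4 x≢y record { len = 0 ; starts₀ = s₀ ; ends₀ = e₀ } = ⊥-elim (x≢y (trans (sym s₀) e₀))
    reversingWalk-len≥4 x≢y record { len = 1 ; hom = hom ; starts₀ = s₀ ; ends₁ = e₁ } =
      ⊥-elim (proj₂ (proj₂ (Edge-distinct isG (hom zero))) (trans s₀ (sym e₁)))
    reversingWalk-len≥4 x≢y record { len = 2 ; hom = hom ; starts₁ = s₁ ; ends₀ = e₀ } =
      ⊥-elim (proj₁ (proj₂ (Edge-distinct isG (hom zero))) (trans s₁ (sym e₀)))
    reversingWalk-len≥4 x≢y record { len = 3 ; hom = hom ; starts₁ = s₁ ; ends₀ = e₀ } =
      ⊥-elim (proj₂ (proj₂ (Edge-distinct isG (hom (suc zero)))) (trans s₁ (sym e₀)))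
    reversingWalk-len≥4 x≢y record { len = suc (suc (suc (suc _))) } = s≤s (s≤s (s≤s (s≤s z≤n)))

    reversiblePair⇒bottle : ReversiblePair G → ContainsBottle G
    reversiblePair⇒bottle (x , y , x≢y , l) =
      pathImage isG vertex hom , pathImage-isBottle isG vertex hom (reversingWalk-len≥4 x≢y W)
        (trans ends₀ (sym starts₁)) (trans ends₁ (sym starts₀)) ,
      pathImage-subhypergraph isG vertex hom
      where
        W : Walk G x y y x
        W = linked-walk l
        open Walk W

    bottle⇒reversiblePair : ContainsBottle G → ReversiblePair G
    bottle⇒reversiblePair (F , (_ , k@(suc _) , _ , f , (_ , homF , _) , closes₁ , closes₀) , g , _ , g-edge) =
      _ , _ , proj₁ (Edge-distinct isG (hom zero)) ,
      subst (Linked G _) (cong₂ _,_ (cong g closes₁) (cong g closes₀)) (path-linked k (λ i → g (f i)) hom)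
      where
        hom : PathHom G k (λ i → g (f i))
        hom i = g-edge _ _ _ (homF i)

-- Orientations

module _ {H : 3Graph} (isH : Is3Graph H) where

  module _ {T : Fin (n H) → Fin (n H) → Set} (asym : ∀ x y → T x y → ¬ T y x)
           (cyclic : ∀ a b c → Edge H a b c → CyclicTriangle T a b c) where

    Shift-preserves : ∀ {p q} → Shift H p q → uncurry T p → uncurry T q
    Shift-preserves (shift e) a→b with cyclic _ _ _ e
    ... | inj₁ (_ , b→c , _) = b→c
    ... | inj₂ (b→a , _ , _) = ⊥-elim (asym _ _ a→b b→a)

    Linked-preserves : ∀ {p q} → Linked H p q → uncurry T p → uncurry T q
    Linked-preserves ε t = t
    Linked-preserves (s ◅ l) t = Linked-preserves l (Shift-preserves s t)

  orientable⇒¬reversiblePair : Orientable H → ¬ ReversiblePair H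
  orientable⇒¬reversiblePair (T , (_ , total , asym) , cyclic) (x , y , x≢y , l) with total x y x≢y
  ... | inj₁ x→y = asym x y x→y (Linked-preserves asym cyclic l x→y)
  ... | inj₂ y→x = asym y x y→x (Linked-preserves asym cyclic (Linked-sym isH l) y→x)

  labelling⇒orientable : (label : Pair H → ℕ) →
    (∀ {x y} → x ≢ y → label (x , y) ≢ label (y , x)) →
    (∀ {a b c} → Edge H a b c → label (a , b) ≡ label (b , c)) →
    Orientable H
  labelling⇒orientable label separates constant = T , (irreflexive , total , asym) , cyclic
    where
      T : Fin (n H) → Fin (n H) → Set
      T x y = label (x , y) < label (y , x)
      irreflexive : ∀ x → ¬ T x x
      irreflexive x = <-irrefl refl
      total : ∀ x y → x ≢ y → T x y ⊎ T y x
      total x y x≢y with <-cmp (label (x , y)) (label (y , x))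
      ... | tri< lt _ _ = inj₁ lt
      ... | tri≈ _ eq _ = ⊥-elim (separates x≢y eq)
      ... | tri> _ _ gt = inj₂ gt
      asym : ∀ x y → T x y → ¬ T y x
      asym x y = <-asym
      cyclic : ∀ a b c → Edge H a b c → CyclicTriangle T a b c
      cyclic a b c e = orient (<-cmp (label (a , b)) (label (b , a)))
        where
          e′ : Edge H b a c
          e′ = proj₁ (Edge-symmetric isH) e
          ab≡bc = constant e
          ab≡ca = trans ab≡bc (constant (Edge-rotate isH e))
          ba≡ac = constant e′
          ba≡cb = trans ba≡ac (constant (Edge-rotate isH e′))
          orient : Tri (label (a , b) < label (b , a)) _ (label (b , a) < label (a , b)) → CyclicTriangle T a b c
          orient (tri< lt _ _) = inj₁ (lt , subst₂ _<_ ab≡bc ba≡cb lt , subst₂ _<_ ab≡ca ba≡ac lt)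
          orient (tri≈ _ eq _) = ⊥-elim (separates (proj₁ (Edge-distinct isH e)) eq)
          orient (tri> _ _ gt) = inj₂ (gt , subst₂ _<_ ba≡cb ab≡bc gt , subst₂ _<_ ba≡ac ab≡ca gt)

  private
    open Merging (Linked-setoid isH)

    Triple : Set
    Triple = Fin (n H) × Fin (n H) × Fin (n H)

    IsEdge : Triple → Set
    IsEdge (a , b , c) = Edge H a b c

    edge? : (t : Triple) → Dec (IsEdge t)
    edge? (a , b , c) = E H a b c Bool.≟ true

    triples : List Triple
    triples = cartesianProduct (allFin (n H)) (cartesianProduct (allFin (n H)) (allFin (n H)))

    link : Triple → Pair H × Pair H
    link (a , b , c) = (a , b) , (b , c)

    link-linked : ∀ t → IsEdge t → uncurry (Linked H) (link t)
    link-linked (a , b , c) e = shift e ◅ ε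

    links : List (Pair H × Pair H)
    links = map link (filter edge? triples)

    pairIndex : Labelling
    pairIndex (x , y) = toℕ (combine x y)

    pairIndex-injective : Injective _≡_ _≡_ pairIndex
    pairIndex-injective {x , y} {x′ , y′} eq with combine-injective x y x′ y′ (toℕ-injective eq)
    ... | refl , refl = refl

    linkClass : Labelling
    linkClass = mergeAll pairIndex links

    linkClass-faithful : Faithful linkClass
    linkClass-faithful = mergeAll-faithful links
      (All-map⁺ (All.map (λ {t} → link-linked t) (all-filter edge? triples)))
      (injective⇒faithful pairIndex-injective)

    linkClass-constant : ∀ {a b c} → Edge H a b c → linkClass (a , b) ≡ linkClass (b , c)
    linkClass-constant {a} {b} {c} e = mergeAll-unifies links (∈-map⁺ link (∈-filter⁺ edge?
      (∈-cartesianProduct⁺ (∈-allFin a) (∈-cartesianProduct⁺ (∈-allFin b) (∈-allFin c))) e))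

  ¬reversiblePair⇒orientable : ¬ ReversiblePair H → Orientable H
  ¬reversiblePair⇒orientable ¬reversible = labelling⇒orientable linkClass
    (λ x≢y eq → ¬reversible (_ , _ , x≢y , linkClass-faithful _ _ eq)) linkClass-constant

proposition3p3 : (H : 3Graph) → Is3Graph H → Orientable H ⇔ (¬ ContainsBottle H)
proposition3p3 H isH = mk⇔
  (λ orientable bottle → orientable⇒¬reversiblePair isH orientable (bottle⇒reversiblePair isH bottle))
  (λ ¬bottle → ¬reversiblePair⇒orientable isH (¬bottle ∘ reversiblePair⇒bottle isH))
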